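{- Let $T$ be a compressed monoidal signature and let $f : G \rightarrow H$ be a morphism of $\mathbf{SGraph}_T$. If $v$ is a vertex of $G$ such that $f(v)$ is an input (respectively output) of $H$, then $v$ is an input (respectively output) of $G$.
   Context: Graphs are finite directed multigraphs (vertex set, edge set, source and target maps); for a graph $\mathcal{G}$, $\mathbf{Graph}/\mathcal{G}$ is the slice category of graphs $G$ equipped with a typing morphism $\tau_G : G \rightarrow \mathcal{G}$, with morphisms the graph morphisms commuting with typings. A compressed monoidal signature $T = (O,M,\mathrm{dom},\mathrm{cod})$ consists of sets $O$, $M$ and functions $\mathrm{dom},\mathrm{cod} : M \rightarrow (O \times \{\mathsf{v},\mathsf{f}\})^*$ into finite lists ($\mathsf{v}$ = variable arity, $\mathsf{f}$ = fixed arity). Its derived compressed typegraph $\mathcal{G}_T$ has vertex set $O \sqcup M$, a self-loop on each $X \in O$, for each $f \in M$ and each index $i$ of $\mathrm{dom}(f)$ with $\mathrm{dom}(f)[i] = (X,a)$ an edge $\mathrm{in}^a_{f,i}$ from $X$ to $f$, and for each index $j$ of $\mathrm{cod}(f)$ with $\mathrm{cod}(f)[j] = (X,a)$ an edge $\mathrm{out}^a_{f,j}$ from $f$ to $X$. In a $\mathcal{G}_T$-typed graph, vertices typed in $O$ are wire-vertices and those typed in $M$ are node-vertices; an edge is fixed-arity if its type is tagged $\mathsf{f}$. A morphism $f$ of $\mathcal{G}_T$-typed graphs (this includes typing morphisms, viewing $\mathcal{G}_T$ as typed by its identity) is arity-matching if for every node-vertex $v$ of its domain, $f$ restricts to a bijection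 from the fixed-arity edges incident to $v$ onto the fixed-arity edges incident to $f(v)$. A string graph is a finite $\mathcal{G}_T$-typed graph $(G,\tau_G)$ with $\tau_G$ arity-matching and in which every wire-vertex has at most one incoming and at most one outgoing edge. $\mathbf{SGraph}_T$ is the full subcategory of $\mathbf{Graph}/\mathcal{G}_T$ on string graphs. An input of a string graph is a wire-vertex with no incoming edge; an output is a wire-vertex with no outgoing edge. -}

module Defs where

open import Level using (0ℓ)
open import Data.Nat using (ℕ)
open import Data.Fin using (Fin)
open import Data.List using (List; length; lookup)
open import Data.Product using (Σ; ∃; _×_; _,_; proj₁; proj₂)
open import Data.Sum using (_⊎_; inj₁; inj₂)
open import Data.Empty using (⊥)
open import Data.Unit using (⊤)
open import Function.Bundles using (_↔_)
open import Relation.Nullary using (¬_)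
open import Relation.Binary.PropositionalEquality using (_≡_)

record Graph : Set₁ where
  field
    V   : Set
    E   : Set
    src : E → V
    tgt : E → V
open Graph public

record GraphMor (G H : Graph) : Set where
  field
    vmap : V G → V H
    emap : E G → E H
    src-comm : ∀ e → src H (emap e) ≡ vmap (src G e)
    tgt-comm : ∀ e → tgt H (emap e) ≡ vmap (tgt G e)
open GraphMor public

IsFinite : Graph → Set
IsFinite G = (∃ λ n → V G ↔ Fin n) × (∃ λ m → E G ↔ Fin m)

data Arity : Set where
  v f : Arity

record Signature : Set₁ where
  field
    O   : Set
    M   : Set
    dom : M → List (O × Arity)
    cod : M → List (O × Arity)
open Signature public

data TEdge (T : Signature) : Set where
  loop : O T → TEdge T
  inE  : (g : M T) → Fin (length (dom T g)) → TEdge T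
  outE : (g : M T) → Fin (length (cod T g)) → TEdge T

tsrc : (T : Signature) → TEdge T → O T ⊎ M T
tsrc T (loop X)   = inj₁ X
tsrc T (inE g i)  = inj₁ (proj₁ (lookup (dom T g) i))
tsrc T (outE g j) = inj₂ g

ttgt : (T : Signature) → TEdge T → O T ⊎ M T
ttgt T (loop X)   = inj₁ X
ttgt T (inE g i)  = inj₂ g
ttgt T (outE g j) = inj₁ (proj₁ (lookup (cod T g) j))

TypeGraph : Signature → Graph
TypeGraph T = record { V = O T ⊎ M T ; E = TEdge T ; src = tsrc T ; tgt = ttgt T }

-- fixed-arity edge types (the self-loops carry no arity tag: not fixed)
isFixedArity : Arity → Set
isFixedArity v = ⊥
isFixedArity f = ⊤

FixedT : (T : Signature) → TEdge T → Set
FixedT T (loop X)   = ⊥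
FixedT T (inE g i)  = isFixedArity (proj₂ (lookup (dom T g) i))
FixedT T (outE g j) = isFixedArity (proj₂ (lookup (cod T g) j))

IsWireT : (T : Signature) → O T ⊎ M T → Set
IsWireT T (inj₁ _) = ⊤
IsWireT T (inj₂ _) = ⊥

IsNodeT : (T : Signature) → O T ⊎ M T → Set
IsNodeT T (inj₁ _) = ⊥
IsNodeT T (inj₂ _) = ⊤

record Typed (T : Signature) : Set₁ where
  field
    graph  : Graph
    typing : GraphMor graph (TypeGraph T)
open Typed public

TypeGraphTyped : (T : Signature) → Typed T
TypeGraphTyped T = record
  { graph = TypeGraph T
  ; typing = record { vmap = λ x → x ; emap = λ e → e
                    ; src-comm = λ _ → Relation.Binary.PropositionalEquality.refl
                    ; tgt-comm = λ _ → Relation.Binary.PropositionalEquality.refl } }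

module _ {T : Signature} (G : Typed T) where
  IsWire : V (graph G) → Set
  IsWire x = IsWireT T (vmap (typing G) x)

  IsNode : V (graph G) → Set
  IsNode x = IsNodeT T (vmap (typing G) x)

  IsFixedEdge : E (graph G) → Set
  IsFixedEdge e = FixedT T (emap (typing G) e)

  IncidentTo : E (graph G) → V (graph G) → Set
  IncidentTo e x = (src (graph G) e ≡ x) ⊎ (tgt (graph G) e ≡ x)

  IsInput : V (graph G) → Set
  IsInput x = IsWire x × (∀ e → ¬ (tgt (graph G) e ≡ x))

  IsOutput : V (graph G) → Set
  IsOutput x = IsWire x × (∀ e → ¬ (src (graph G) e ≡ x))

record TypedMor {T : Signature} (G H : Typed T) : Set where
  field
    mor : GraphMor (graph G) (graph H)
    vtype-comm : ∀ x → vmap (typing H) (vmap mor x) ≡ vmap (typing G) x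
    etype-comm : ∀ e → emap (typing H) (emap mor e) ≡ emap (typing G) e
open TypedMor public

-- arity-matching: for each node-vertex x of the domain, the edge map restricts
-- to a bijection from fixed-arity edges incident to x onto fixed-arity edges
-- incident to the image of x
ArityMatching : {T : Signature} (G H : Typed T) → GraphMor (graph G) (graph H) → Set
ArityMatching G H φ =
  ∀ x → IsNode G x →
    ((∀ e → IsFixedEdge G e → IncidentTo G e x → IsFixedEdge H (emap φ e) × IncidentTo H (emap φ e) (vmap φ x))
    × (∀ e₁ e₂ → IsFixedEdge G e₁ → IncidentTo G e₁ x → IsFixedEdge G e₂ → IncidentTo G e₂ x
         → emap φ e₁ ≡ emap φ e₂ → e₁ ≡ e₂))
    × (∀ e' → IsFixedEdge H e' → IncidentTo H e' (vmap φ x)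
         → Σ (E (graph G)) λ e → IsFixedEdge G e × IncidentTo G e x × (emap φ e ≡ e'))

record IsStringGraph {T : Signature} (G : Typed T) : Set where
  field
    finite : IsFinite (graph G)
    typing-arity-matching : ArityMatching G (TypeGraphTyped T) (typing G)
    wire-in  : ∀ x → IsWire G x → ∀ e₁ e₂ → tgt (graph G) e₁ ≡ x → tgt (graph G) e₂ ≡ x → e₁ ≡ e₂
    wire-out : ∀ x → IsWire G x → ∀ e₁ e₂ → src (graph G) e₁ ≡ x → src (graph G) e₂ ≡ x → e₁ ≡ e₂

record StringGraph (T : Signature) : Set₁ where
  field
    typed : Typed T
    isString : IsStringGraph typed
open StringGraph public

SGraphMor : {T : Signature} → StringGraph T → StringGraph T → Set
SGraphMor G H = TypedMor (typed G) (typed H)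

module Submission where

-- A vertex is an input when it is a wire-vertex with no incoming edge, and an
-- output when it is a wire-vertex with no outgoing edge.  Both halves of this
-- description are reflected along any morphism of 𝒢_T-typed graphs:
--   * a typed morphism preserves types, so x is a wire-vertex as soon as its
--     image is one;
--   * a graph morphism sends an edge into (out of) x to an edge into (out of)
--     the image of x, so if the image has no incoming (outgoing) edge, neither
--     does x.

open import Defs
open import Data.Product using (_×_; _,_)
open import Relation.Nullary using (¬_)
open import Relation.Binary.PropositionalEquality using (_≡_; trans; cong; subst)

no-incoming-reflected : {G H : Graph} (φ : GraphMor G H) (x : V G) →
  (∀ e′ → ¬ (tgt H e′ ≡ vmap φ x)) → ∀ e → ¬ (tgt G e ≡ x)
no-incoming-reflected φ x none e tgt≡x =
  none (emap φ e) (trans (tgt-comm φ e) (cong (vmap φ) tgt≡x))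

no-outgoing-reflected : {G H : Graph} (φ : GraphMor G H) (x : V G) →
  (∀ e′ → ¬ (src H e′ ≡ vmap φ x)) → ∀ e → ¬ (src G e ≡ x)
no-outgoing-reflected φ x none e src≡x =
  none (emap φ e) (trans (src-comm φ e) (cong (vmap φ) src≡x))

wire-reflected : {T : Signature} {G H : Typed T} (φ : TypedMor G H)
  (x : V (graph G)) → IsWire H (vmap (mor φ) x) → IsWire G x
wire-reflected {T} φ x = subst (IsWireT T) (vtype-comm φ x)

input-reflected : {T : Signature} {G H : Typed T} (φ : TypedMor G H)
  (x : V (graph G)) → IsInput H (vmap (mor φ) x) → IsInput G x
input-reflected φ x (wire , no-in) =
  wire-reflected φ x wire , no-incoming-reflected (mor φ) x no-in

output-reflected : {T : Signature} {G H : Typed T} (φ : TypedMor G H)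
  (x : V (graph G)) → IsOutput H (vmap (mor φ) x) → IsOutput G x
output-reflected φ x (wire , no-out) =
  wire-reflected φ x wire , no-outgoing-reflected (mor φ) x no-out

lemma3p17 : (T : Signature) (G H : StringGraph T) (φ : SGraphMor G H)
    (x : V (graph (typed G))) →
    (IsInput (typed H) (vmap (mor φ) x) → IsInput (typed G) x)
    × (IsOutput (typed H) (vmap (mor φ) x) → IsOutput (typed G) x)
lemma3p17 T G H φ x = input-reflected φ x , output-reflected φ x
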